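{- Let $H$ be a definite quaternion algebra over $\mathbb{Q}$ of discriminant $D$ and let $\mathcal{O}\subseteq H$ be an Eichler order over $\mathbb{Z}$ of level $N$ with one-sided ideal class number $h(D,N)=1$. Let $\xi\in\mathcal{O}$. Then $\mathcal{P}=\{1+\xi\mathcal{O}\}$ is a $\xi$-primary class set for $\mathcal{O}$ if and only if $\xi$ satisfies the right-unit property in $\mathcal{O}$.
   Context: $\mathrm{Nm}$ denotes the reduced norm. For $\gamma\in\mathcal{O}$, let $\lambda_r:\mathcal{O}/\mathrm{Nm}(\gamma)\mathcal{O}\twoheadrightarrow\mathcal{O}/\gamma\mathcal{O}$ be the natural projection and $(\mathcal{O}/\gamma\mathcal{O})_r^{\times}$ the image under $\lambda_r$ of the unit group $(\mathcal{O}/\mathrm{Nm}(\gamma)\mathcal{O})^{\times}$. The group $\mathcal{O}^\times$ acts on $(\mathcal{O}/\xi\mathcal{O})_r^{\times}$ by right multiplication, $(\alpha+\xi\mathcal{O})u=\alpha u+\xi\mathcal{O}$. A subset $\mathcal{P}\subseteq(\mathcal{O}/\xi\mathcal{O})_r^{\times}$ is a $\xi$-primary class set for $\mathcal{O}$ if it is a system of representatives of the orbits of this action and moreover $\mathcal{O}^\times$ acts freely on $(\mathcal{O}/\xi\mathcal{O})_r^{\times}$ when $2\notin\xi\mathcal{O}$, respectively $\mathcal{O}^\times/\mathbb{Z}^\times$ acts freely when $2\in\xi\mathcal{O}$. The element $\xi$ satisfies the right-unit property if $u\mapsto u+\xi\mathcal{O}$ is a bijection $\mathcal{O}^{\times}\to(\mathcal{O}/\xi\mathcal{O})_r^{\times}$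 when $2\notin\xi\mathcal{O}$, respectively a bijection $\mathcal{O}^{\times}/\mathbb{Z}^{\times}\to(\mathcal{O}/\xi\mathcal{O})_r^{\times}$ when $2\in\xi\mathcal{O}$. -}

module Defs where

open import Data.Rational using (ℚ; 0ℚ; 1ℚ; _+_; _*_; _-_; -_; _<_; _/_)
open import Data.Integer using (ℤ)
open import Data.Fin using (Fin; zero; suc)
open import Data.Product using (Σ; ∃; _×_; _,_)
open import Data.Sum using (_⊎_)
open import Relation.Binary.PropositionalEquality using (_≡_; _≢_)
open import Relation.Nullary using (¬_)

-- Quaternion algebras over ℚ, presented as (a,b | ℚ):
-- basis 1,i,j,k with i² = a, j² = b, ij = -ji = k  (a, b ≠ 0).
-- Every quaternion algebra over ℚ is isomorphic to one of these.

record QuatAlg : Set where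
  field
    a b : ℚ
    a≢0 : a ≢ 0ℚ
    b≢0 : b ≢ 0ℚ

-- elements x₀ + x₁ i + x₂ j + x₃ k
record Quat : Set where
  constructor quat
  field
    c₀ c₁ c₂ c₃ : ℚ
open Quat public

0H : Quat
0H = quat 0ℚ 0ℚ 0ℚ 0ℚ

1H : Quat
1H = quat 1ℚ 0ℚ 0ℚ 0ℚ

scalarH : ℚ → Quat
scalarH q = quat q 0ℚ 0ℚ 0ℚ

_+H_ : Quat → Quat → Quat
x +H y = quat (c₀ x + c₀ y) (c₁ x + c₁ y) (c₂ x + c₂ y) (c₃ x + c₃ y)

-H_ : Quat → Quat
-H x = quat (- c₀ x) (- c₁ x) (- c₂ x) (- c₃ x)

_-H_ : Quat → Quat → Quat
x -H y = x +H (-H y)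

_·H_ : ℚ → Quat → Quat
q ·H x = quat (q * c₀ x) (q * c₁ x) (q * c₂ x) (q * c₃ x)

module _ (A : QuatAlg) where
  open QuatAlg A

  mulH : Quat → Quat → Quat
  mulH (quat x₀ x₁ x₂ x₃) (quat y₀ y₁ y₂ y₃) = quat
    (x₀ * y₀ + a * (x₁ * y₁) + b * (x₂ * y₂) - a * b * (x₃ * y₃))
    (x₀ * y₁ + x₁ * y₀ - b * (x₂ * y₃) + b * (x₃ * y₂))
    (x₀ * y₂ + x₂ * y₀ + a * (x₁ * y₃) - a * (x₃ * y₁))
    (x₀ * y₃ + x₃ * y₀ + x₁ * y₂ - x₂ * y₁)

  Nm : Quat → ℚ
  Nm (quat x₀ x₁ x₂ x₃) =
    x₀ * x₀ - a * (x₁ * x₁) - b * (x₂ * x₂) + a * b * (x₃ * x₃)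

  -- H is definite: H ⊗ ℝ is a division algebra, i.e. the reduced norm
  -- form is positive definite
  Definite : Set
  Definite = ∀ x → x ≢ 0H → 0ℚ < Nm x

-- Full ℤ-lattices in H, given by a ℚ-basis of H

ℤ→ℚ : ℤ → ℚ
ℤ→ℚ z = z / 1

comb : (Fin 4 → ℚ) → (Fin 4 → Quat) → Quat
comb q e = (q zero ·H e zero) +H ((q (suc zero) ·H e (suc zero))
  +H ((q (suc (suc zero)) ·H e (suc (suc zero)))
  +H (q (suc (suc (suc zero))) ·H e (suc (suc (suc zero))))))

record Lattice : Set where
  field
    basis : Fin 4 → Quat
    indep : ∀ (q : Fin 4 → ℚ) → comb q basis ≡ 0H → ∀ i → q i ≡ 0ℚ

_∈L_ : Quat → Lattice → Set
x ∈L L = Σ (Fin 4 → ℤ) λ n → x ≡ comb (λ i → ℤ→ℚ (n i)) (Lattice.basis L)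

_⊆L_ : Lattice → Lattice → Set
L ⊆L M = ∀ x → x ∈L L → x ∈L M

_≈L_ : Lattice → Lattice → Set
L ≈L M = ∀ x → (x ∈L L → x ∈L M) × (x ∈L M → x ∈L L)

module _ (A : QuatAlg) where

  private
    _⋆_ : Quat → Quat → Quat
    _⋆_ = mulH A

  -- membership in the product lattice L M (ℤ-span of all products)
  _∈LL_,_ : Quat → Lattice → Lattice → Set
  x ∈LL L , M = Σ (Fin 4 → Fin 4 → ℤ) λ n →
    x ≡ comb (λ i → 1ℚ) (λ i → comb (λ j → ℤ→ℚ (n i j))
             (λ j → Lattice.basis L i ⋆ Lattice.basis M j))

  ProdEq : Lattice → Lattice → Lattice → Set
  ProdEq L M K = ∀ x → (x ∈LL L , M → x ∈L K) × (x ∈L K → x ∈LL L , M)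

  IsOrder : Lattice → Set
  IsOrder O = (1H ∈L O) × (∀ x y → x ∈L O → y ∈L O → (x ⋆ y) ∈L O)

  IsMaximalOrder : Lattice → Set
  IsMaximalOrder O = IsOrder O × (∀ O' → IsOrder O' → O ⊆L O' → O' ⊆L O)

  IsEichlerOrder : Lattice → Set
  IsEichlerOrder O = IsOrder O × Σ Lattice λ O₁ → Σ Lattice λ O₂ →
    IsMaximalOrder O₁ × IsMaximalOrder O₂ ×
    (∀ x → (x ∈L O → x ∈L O₁ × x ∈L O₂) × (x ∈L O₁ × x ∈L O₂ → x ∈L O))

  IsLeftOrderOf : Lattice → Lattice → Set
  IsLeftOrderOf O I = ∀ α → (α ∈L O → ∀ x → x ∈L I → (α ⋆ x) ∈L I)
                          × ((∀ x → x ∈L I → (α ⋆ x) ∈L I) → α ∈L O)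

  IsRightOrderOf : Lattice → Lattice → Set
  IsRightOrderOf O I = ∀ α → (α ∈L O → ∀ x → x ∈L I → (x ⋆ α) ∈L I)
                           × ((∀ x → x ∈L I → (x ⋆ α) ∈L I) → α ∈L O)

  -- invertible (equivalently: locally principal) lattice with right order O
  IsInvertibleRightIdeal : Lattice → Lattice → Set
  IsInvertibleRightIdeal O I = IsRightOrderOf O I ×
    Σ Lattice λ Oₗ → IsLeftOrderOf Oₗ I × Σ Lattice λ J → ProdEq I J Oₗ × ProdEq J I O

  IsPrincipalRightIdeal : Lattice → Lattice → Set
  IsPrincipalRightIdeal O I = Σ Quat λ α → (Nm A α ≢ 0ℚ) ×
    (∀ x → (x ∈L I → Σ Quat λ y → y ∈L O × x ≡ α ⋆ y)
         × ((Σ Quat λ y → y ∈L O × x ≡ α ⋆ y) → x ∈L I))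

  -- one-sided (right) ideal class number equal to 1: every locally
  -- principal (= invertible) fractional right O-ideal is principal
  ClassNumberOne : Lattice → Set
  ClassNumberOne O = ∀ I → IsInvertibleRightIdeal O I → IsPrincipalRightIdeal O I

  module _ (O : Lattice) (ξ : Quat) where

    _≡ξ_ : Quat → Quat → Set
    α ≡ξ β = Σ Quat λ γ → γ ∈L O × (α -H β) ≡ ξ ⋆ γ

    _≡N_ : Quat → Quat → Set
    α ≡N β = Σ Quat λ γ → γ ∈L O × (α -H β) ≡ (Nm A ξ ·H γ)

    UnitModN : Quat → Set
    UnitModN α = α ∈L O × Σ Quat λ β → β ∈L O × ((α ⋆ β) ≡N 1H) × ((β ⋆ α) ≡N 1H)

    -- α + ξO ∈ (O/ξO)_r^× = λ_r((O/Nm(ξ)O)^×)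
    InRUnits : Quat → Set
    InRUnits α = α ∈L O × Σ Quat λ α' → UnitModN α' × (α ≡ξ α')

    Unit : Quat → Set
    Unit u = u ∈L O × Σ Quat λ v → v ∈L O × (u ⋆ v ≡ 1H) × (v ⋆ u ≡ 1H)

    TwoIn : Set
    TwoIn = scalarH (ℤ→ℚ (Data.Integer.+ 2)) ≡ξ 0H

    -- P ⊆ (O/ξO)_r^×, a set of residue classes, given by a predicate on
    -- representatives (assumed compatible with ≡ξ).
    IsPrimaryClassSet : (Quat → Set) → Set
    IsPrimaryClassSet P =
      (∀ β → P β → InRUnits β)
      × (∀ α → InRUnits α → Σ Quat λ β → P β × Σ Quat λ u → Unit u × (α ≡ξ (β ⋆ u)))
      × (∀ β β' → P β → P β' → (Σ Quat λ u → Unit u × (β' ≡ξ (β ⋆ u))) → β ≡ξ β')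
      -- freeness of the action of O^× (2 ∉ ξO), resp. O^×/ℤ^× (2 ∈ ξO)
      × ((¬ TwoIn → ∀ α u → InRUnits α → Unit u → (α ⋆ u) ≡ξ α → u ≡ 1H)
       × (TwoIn → ∀ α u → InRUnits α → Unit u → (α ⋆ u) ≡ξ α → (u ≡ 1H ⊎ u ≡ -H 1H)))

    OneClass : Quat → Set
    OneClass β = β ≡ξ 1H

    -- right-unit property: u ↦ u + ξO is a bijection O^× → (O/ξO)_r^×
    -- (resp. O^×/ℤ^× → (O/ξO)_r^× when 2 ∈ ξO)
    RightUnitProperty : Set
    RightUnitProperty =
      (∀ u → Unit u → InRUnits u)
      × (∀ α → InRUnits α → Σ Quat λ u → Unit u × (α ≡ξ u))
      × ((¬ TwoIn → ∀ u v → Unit u → Unit v → u ≡ξ v → u ≡ v)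
       × (TwoIn → ∀ u v → Unit u → Unit v → u ≡ξ v → (u ≡ v ⊎ u ≡ -H v)))

{-# OPTIONS --safe #-}
module Submission where

-- Write α ~ β for α ≡ β (mod ξO); right multiplication
-- by elements of O preserves ~.  If {1 + ξO} is a primary class set, every class of
-- (O/ξO)_r^× has the form 1·u + ξO with u a unit, and for units u ~ v the unit v⁻¹u fixes the
-- class of v, so freeness gives v⁻¹u = 1 (resp. ±1).  Conversely, a class fixed by a unit u
-- contains a unit w by the right-unit property, so wu ~ w, and injectivity gives wu = w
-- (resp. ±w), that is u = 1 (resp. ±1).

open import Defs
open import Data.Product using (_×_)
open import Function.Bundles using (_⇔_; mk⇔)

open import Algebra.Properties.Group using (⁻¹-involutive)
open import Data.Fin using (Fin; #_)
open import Data.Fin.Patterns using (0F; 1F; 2F; 3F)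
open import Data.Integer as ℤ using (+_; -[1+_])
import Data.Integer.Tactic.RingSolver as ℤ-Solver
open import Data.Product using (Σ; _,_; proj₁; proj₂)
open import Data.Rational using (ℚ; 0ℚ; 1ℚ; _+_; _*_; -_)
open import Data.Rational.Base using (toℚᵘ)
open import Data.Rational.Properties
  using (+-*-commutativeRing; +-0-group; _≟_; *-zeroʳ; toℚᵘ-injective; toℚᵘ-fromℚᵘ; toℚᵘ-homo-+)
open import Data.Rational.Unnormalised as ℚᵘ using (mkℚᵘ; *≡*)
import Data.Rational.Unnormalised.Properties as ℚᵘ
open import Data.Sum using (_⊎_; inj₁; inj₂)
open import Data.Vec using (Vec; []; _∷_)
open import Function using (_∘_)
open import Level using (0ℓ)
open import Relation.Binary.PropositionalEquality
open import Relation.Nullary.Decidable using (dec⇒maybe)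
open import Tactic.RingSolver using (solve-∀)
open import Tactic.RingSolver.Core.AlmostCommutativeRing
  using (AlmostCommutativeRing; fromCommutativeRing)

ℚ-ring : AlmostCommutativeRing 0ℓ 0ℓ
ℚ-ring = fromCommutativeRing +-*-commutativeRing (λ x → dec⇒maybe (0ℚ ≟ x))

open import Tactic.RingSolver.NonReflective ℚ-ring using (Expr; Κ; Ι; _⊕_; _⊗_; ⊝_; module Ops)

quat-cong : ∀ {x₀ x₁ x₂ x₃ y₀ y₁ y₂ y₃} →
            x₀ ≡ y₀ → x₁ ≡ y₁ → x₂ ≡ y₂ → x₃ ≡ y₃ → quat x₀ x₁ x₂ x₃ ≡ quat y₀ y₁ y₂ y₃
quat-cong refl refl refl refl = refl

-- Identities of (a,b | ℚ) are polynomial identities in the structure constants a, b and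
-- the coordinates of (at most) three quaternions x, y, z.  Quaternion terms over these
-- fourteen variables evaluate definitionally to the operations of Defs, so the ring solver
-- proves such an identity coordinatewise; variables an identity does not use may be set to
-- anything (0ℚ, 0H).
module QuaternionTerms where

  Term : Set
  Term = Expr ℚ 14

  record QuatTerm : Set where
    constructor quatₜ
    field t₀ t₁ t₂ t₃ : Term
  open QuatTerm

  aₜ bₜ : Term
  aₜ = Ι (# 0)
  bₜ = Ι (# 1)

  xₜ yₜ zₜ : QuatTerm
  xₜ = quatₜ (Ι (# 2)) (Ι (# 3)) (Ι (# 4)) (Ι (# 5))
  yₜ = quatₜ (Ι (# 6)) (Ι (# 7)) (Ι (# 8)) (Ι (# 9))
  zₜ = quatₜ (Ι (# 10)) (Ι (# 11)) (Ι (# 12)) (Ι (# 13))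

  env : ℚ → ℚ → Quat → Quat → Quat → Vec ℚ 14
  env a b x y z = a ∷ b ∷ c₀ x ∷ c₁ x ∷ c₂ x ∷ c₃ x ∷ c₀ y ∷ c₁ y ∷ c₂ y ∷ c₃ y
                    ∷ c₀ z ∷ c₁ z ∷ c₂ z ∷ c₃ z ∷ []

  ⟦_⟧ : QuatTerm → Vec ℚ 14 → Quat
  ⟦ quatₜ t₀ t₁ t₂ t₃ ⟧ ρ = quat (Ops.⟦ t₀ ⟧ ρ) (Ops.⟦ t₁ ⟧ ρ) (Ops.⟦ t₂ ⟧ ρ) (Ops.⟦ t₃ ⟧ ρ)

  infixl 6 _⊖_ _+ₜ_ _-ₜ_
  infixl 7 _*ₜ_

  _⊖_ : Term → Term → Term
  s ⊖ t = s ⊕ (⊝ t)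

  0ₜ 1ₜ : QuatTerm
  0ₜ = quatₜ (Κ 0ℚ) (Κ 0ℚ) (Κ 0ℚ) (Κ 0ℚ)
  1ₜ = quatₜ (Κ 1ℚ) (Κ 0ℚ) (Κ 0ℚ) (Κ 0ℚ)

  _+ₜ_ : QuatTerm → QuatTerm → QuatTerm
  quatₜ x₀ x₁ x₂ x₃ +ₜ quatₜ y₀ y₁ y₂ y₃ = quatₜ (x₀ ⊕ y₀) (x₁ ⊕ y₁) (x₂ ⊕ y₂) (x₃ ⊕ y₃)

  -ₜ_ : QuatTerm → QuatTerm
  -ₜ quatₜ x₀ x₁ x₂ x₃ = quatₜ (⊝ x₀) (⊝ x₁) (⊝ x₂) (⊝ x₃)

  _-ₜ_ : QuatTerm → QuatTerm → QuatTerm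
  x -ₜ y = x +ₜ (-ₜ y)

  _*ₜ_ : QuatTerm → QuatTerm → QuatTerm
  quatₜ x₀ x₁ x₂ x₃ *ₜ quatₜ y₀ y₁ y₂ y₃ = quatₜ
    (x₀ ⊗ y₀ ⊕ aₜ ⊗ (x₁ ⊗ y₁) ⊕ bₜ ⊗ (x₂ ⊗ y₂) ⊖ aₜ ⊗ bₜ ⊗ (x₃ ⊗ y₃))
    (x₀ ⊗ y₁ ⊕ x₁ ⊗ y₀ ⊖ bₜ ⊗ (x₂ ⊗ y₃) ⊕ bₜ ⊗ (x₃ ⊗ y₂))
    (x₀ ⊗ y₂ ⊕ x₂ ⊗ y₀ ⊕ aₜ ⊗ (x₁ ⊗ y₃) ⊖ aₜ ⊗ (x₃ ⊗ y₁))
    (x₀ ⊗ y₃ ⊕ x₃ ⊗ y₀ ⊕ x₁ ⊗ y₂ ⊖ x₂ ⊗ y₁)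

  ⟦_⇓⟧ : QuatTerm → Vec ℚ 14 → Quat
  ⟦ quatₜ t₀ t₁ t₂ t₃ ⇓⟧ ρ = quat (Ops.⟦ t₀ ⇓⟧ ρ) (Ops.⟦ t₁ ⇓⟧ ρ) (Ops.⟦ t₂ ⇓⟧ ρ) (Ops.⟦ t₃ ⇓⟧ ρ)

  byNormalisation : ∀ X Y → (∀ ρ → ⟦ X ⇓⟧ ρ ≡ ⟦ Y ⇓⟧ ρ) → ∀ ρ → ⟦ X ⟧ ρ ≡ ⟦ Y ⟧ ρ
  byNormalisation (quatₜ x₀ x₁ x₂ x₃) (quatₜ y₀ y₁ y₂ y₃) X⇓≡Y⇓ ρ = quat-cong
    (Ops.prove ρ x₀ y₀ (cong c₀ (X⇓≡Y⇓ ρ))) (Ops.prove ρ x₁ y₁ (cong c₁ (X⇓≡Y⇓ ρ)))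
    (Ops.prove ρ x₂ y₂ (cong c₂ (X⇓≡Y⇓ ρ))) (Ops.prove ρ x₃ y₃ (cong c₃ (X⇓≡Y⇓ ρ)))

open QuaternionTerms using (xₜ; yₜ; zₜ; 0ₜ; 1ₜ; _+ₜ_; -ₜ_; _-ₜ_; _*ₜ_; env; byNormalisation)

x-x≡0H : ∀ x → x -H x ≡ 0H
x-x≡0H x = byNormalisation (xₜ -ₜ xₜ) 0ₜ (λ _ → refl) (env 0ℚ 0ℚ x 0H 0H)

-[x-y]≡y-x : ∀ x y → -H (x -H y) ≡ y -H x
-[x-y]≡y-x x y = byNormalisation (-ₜ (xₜ -ₜ yₜ)) (yₜ -ₜ xₜ) (λ _ → refl) (env 0ℚ 0ℚ x y 0H)

[x-y]+[y-z]≡x-z : ∀ x y z → (x -H y) +H (y -H z) ≡ x -H z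
[x-y]+[y-z]≡x-z x y z =
  byNormalisation ((xₜ -ₜ yₜ) +ₜ (yₜ -ₜ zₜ)) (xₜ -ₜ zₜ) (λ _ → refl) (env 0ℚ 0ℚ x y z)

[x-y]+y≡x : ∀ x y → (x -H y) +H y ≡ x
[x-y]+y≡x x y = byNormalisation ((xₜ -ₜ yₜ) +ₜ yₜ) xₜ (λ _ → refl) (env 0ℚ 0ℚ x y 0H)

·H-zeroʳ : ∀ q → q ·H 0H ≡ 0H
·H-zeroʳ q = quat-cong (*-zeroʳ q) (*-zeroʳ q) (*-zeroʳ q) (*-zeroʳ q)

_≈±_ : Quat → Quat → Set
u ≈± v = u ≡ v ⊎ u ≡ -H v

module QuaternionRing (A : QuatAlg) where
  open QuatAlg A using (a; b)

  _⋆_ : Quat → Quat → Quat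
  _⋆_ = mulH A

  ⋆-assoc : ∀ x y z → (x ⋆ y) ⋆ z ≡ x ⋆ (y ⋆ z)
  ⋆-assoc x y z = byNormalisation (xₜ *ₜ yₜ *ₜ zₜ) (xₜ *ₜ (yₜ *ₜ zₜ)) (λ _ → refl) (env a b x y z)

  ⋆-identityˡ : ∀ x → 1H ⋆ x ≡ x
  ⋆-identityˡ x = byNormalisation (1ₜ *ₜ xₜ) xₜ (λ _ → refl) (env a b x 0H 0H)

  ⋆-identityʳ : ∀ x → x ⋆ 1H ≡ x
  ⋆-identityʳ x = byNormalisation (xₜ *ₜ 1ₜ) xₜ (λ _ → refl) (env a b x 0H 0H)

  ⋆-zeroʳ : ∀ x → x ⋆ 0H ≡ 0H
  ⋆-zeroʳ x = byNormalisation (xₜ *ₜ 0ₜ) 0ₜ (λ _ → refl) (env a b x 0H 0H)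

  ⋆-distribˡ-+ : ∀ x y z → x ⋆ (y +H z) ≡ (x ⋆ y) +H (x ⋆ z)
  ⋆-distribˡ-+ x y z =
    byNormalisation (xₜ *ₜ (yₜ +ₜ zₜ)) (xₜ *ₜ yₜ +ₜ xₜ *ₜ zₜ) (λ _ → refl) (env a b x y z)

  ⋆-distribʳ-- : ∀ x y z → (x -H y) ⋆ z ≡ (x ⋆ z) -H (y ⋆ z)
  ⋆-distribʳ-- x y z =
    byNormalisation ((xₜ -ₜ yₜ) *ₜ zₜ) (xₜ *ₜ zₜ -ₜ yₜ *ₜ zₜ) (λ _ → refl) (env a b x y z)

  -‿distribʳ-⋆ : ∀ x y → -H (x ⋆ y) ≡ x ⋆ (-H y)
  -‿distribʳ-⋆ x y =
    byNormalisation (-ₜ (xₜ *ₜ yₜ)) (xₜ *ₜ (-ₜ yₜ)) (λ _ → refl) (env a b x y 0H)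

  ⋆-cancelˡ : ∀ c d x → c ⋆ d ≡ 1H → c ⋆ (d ⋆ x) ≡ x
  ⋆-cancelˡ c d x cd≡1 = trans (sym (⋆-assoc c d x)) (trans (cong (_⋆ x) cd≡1) (⋆-identityˡ x))

  ≈±-⋆-congˡ : ∀ c {x y} → x ≈± y → (c ⋆ x) ≈± (c ⋆ y)
  ≈±-⋆-congˡ c (inj₁ refl) = inj₁ refl
  ≈±-⋆-congˡ c {y = y} (inj₂ refl) = inj₂ (sym (-‿distribʳ-⋆ c y))

-- ℤ→ℚ k and fromℚᵘ (mkℚᵘ k 0) are the same term k / 1.
ℤ→ℚ-+ : ∀ m n → ℤ→ℚ (m ℤ.+ n) ≡ ℤ→ℚ m + ℤ→ℚ n
ℤ→ℚ-+ m n = toℚᵘ-injective (begin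
  toℚᵘ (ℤ→ℚ (m ℤ.+ n))            ≈⟨ toℚᵘ-fromℚᵘ (mkℚᵘ (m ℤ.+ n) 0) ⟩
  mkℚᵘ (m ℤ.+ n) 0                ≈⟨ *≡* (cross-multiplied m n) ⟩
  mkℚᵘ m 0 ℚᵘ.+ mkℚᵘ n 0          ≈⟨ ℚᵘ.+-cong (toℚᵘ-fromℚᵘ (mkℚᵘ m 0)) (toℚᵘ-fromℚᵘ (mkℚᵘ n 0)) ⟨
  toℚᵘ (ℤ→ℚ m) ℚᵘ.+ toℚᵘ (ℤ→ℚ n)  ≈⟨ toℚᵘ-homo-+ (ℤ→ℚ m) (ℤ→ℚ n) ⟨
  toℚᵘ (ℤ→ℚ m + ℤ→ℚ n)            ∎)
  where
  open ℚᵘ.≃-Reasoning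
  cross-multiplied : ∀ m n → (m ℤ.+ n) ℤ.* + 1 ≡ (m ℤ.* + 1 ℤ.+ n ℤ.* + 1) ℤ.* + 1
  cross-multiplied = ℤ-Solver.solve-∀

ℤ→ℚ-neg : ∀ n → ℤ→ℚ (ℤ.- n) ≡ - ℤ→ℚ n
ℤ→ℚ-neg (+ 0)      = refl
ℤ→ℚ-neg ℤ.+[1+ n ] = refl
ℤ→ℚ-neg -[1+ n ]   = sym (⁻¹-involutive +-0-group _)

-- Each coordinate c (comb p e) unfolds to dot p (c ∘ e).
dot : (Fin 4 → ℚ) → (Fin 4 → ℚ) → ℚ
dot p v = p 0F * v 0F + (p 1F * v 1F + (p 2F * v 2F + p 3F * v 3F))

dot-+ˡ : ∀ p q v → dot (λ i → p i + q i) v ≡ dot p v + dot q v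
dot-+ˡ p q v =
  expand (p 0F) (p 1F) (p 2F) (p 3F) (q 0F) (q 1F) (q 2F) (q 3F) (v 0F) (v 1F) (v 2F) (v 3F)
  where
  expand : ∀ p₀ p₁ p₂ p₃ q₀ q₁ q₂ q₃ v₀ v₁ v₂ v₃ →
    (p₀ + q₀) * v₀ + ((p₁ + q₁) * v₁ + ((p₂ + q₂) * v₂ + (p₃ + q₃) * v₃))
      ≡ (p₀ * v₀ + (p₁ * v₁ + (p₂ * v₂ + p₃ * v₃))) + (q₀ * v₀ + (q₁ * v₁ + (q₂ * v₂ + q₃ * v₃)))
  expand = solve-∀ ℚ-ring

dot-negˡ : ∀ p v → dot (λ i → - p i) v ≡ - dot p v
dot-negˡ p v = expand (p 0F) (p 1F) (p 2F) (p 3F) (v 0F) (v 1F) (v 2F) (v 3F)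
  where
  expand : ∀ p₀ p₁ p₂ p₃ v₀ v₁ v₂ v₃ →
    - p₀ * v₀ + (- p₁ * v₁ + (- p₂ * v₂ + - p₃ * v₃))
      ≡ - (p₀ * v₀ + (p₁ * v₁ + (p₂ * v₂ + p₃ * v₃)))
  expand = solve-∀ ℚ-ring

dot-zeroˡ : ∀ v → dot (λ _ → 0ℚ) v ≡ 0ℚ
dot-zeroˡ v = expand (v 0F) (v 1F) (v 2F) (v 3F)
  where
  expand : ∀ v₀ v₁ v₂ v₃ → 0ℚ * v₀ + (0ℚ * v₁ + (0ℚ * v₂ + 0ℚ * v₃)) ≡ 0ℚ
  expand = solve-∀ ℚ-ring

comb-+ : ∀ p q e → comb (λ i → p i + q i) e ≡ comb p e +H comb q e
comb-+ p q e = quat-cong (dot-+ˡ p q (c₀ ∘ e)) (dot-+ˡ p q (c₁ ∘ e))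
                         (dot-+ˡ p q (c₂ ∘ e)) (dot-+ˡ p q (c₃ ∘ e))

comb-neg : ∀ p e → comb (λ i → - p i) e ≡ -H comb p e
comb-neg p e = quat-cong (dot-negˡ p (c₀ ∘ e)) (dot-negˡ p (c₁ ∘ e))
                         (dot-negˡ p (c₂ ∘ e)) (dot-negˡ p (c₃ ∘ e))

comb-zero : ∀ e → comb (λ _ → 0ℚ) e ≡ 0H
comb-zero e = quat-cong (dot-zeroˡ (c₀ ∘ e)) (dot-zeroˡ (c₁ ∘ e))
                        (dot-zeroˡ (c₂ ∘ e)) (dot-zeroˡ (c₃ ∘ e))

comb-congˡ : ∀ p q e → (∀ i → p i ≡ q i) → comb p e ≡ comb q e
comb-congˡ p q e p≗q
  rewrite p≗q 0F | p≗q 1F | p≗q 2F | p≗q 3F = refl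

module _ (L : Lattice) where
  open Lattice L using (basis)

  0H∈L : 0H ∈L L
  0H∈L = (λ _ → + 0) , sym (comb-zero basis)

  +H-∈L : ∀ {x y} → x ∈L L → y ∈L L → (x +H y) ∈L L
  +H-∈L (m , refl) (n , refl) = (λ i → m i ℤ.+ n i) , (begin
    comb (ℤ→ℚ ∘ m) basis +H comb (ℤ→ℚ ∘ n) basis  ≡⟨ comb-+ (ℤ→ℚ ∘ m) (ℤ→ℚ ∘ n) basis ⟨
    comb (λ i → ℤ→ℚ (m i) + ℤ→ℚ (n i)) basis      ≡⟨ comb-congˡ _ _ basis (λ i → ℤ→ℚ-+ (m i) (n i)) ⟨
    comb (λ i → ℤ→ℚ (m i ℤ.+ n i)) basis          ∎)
    where open ≡-Reasoning

  -H-∈L : ∀ {x} → x ∈L L → (-H x) ∈L L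
  -H-∈L (n , refl) = (λ i → ℤ.- n i) , (begin
    -H comb (ℤ→ℚ ∘ n) basis           ≡⟨ comb-neg (ℤ→ℚ ∘ n) basis ⟨
    comb (λ i → - ℤ→ℚ (n i)) basis    ≡⟨ comb-congˡ _ _ basis (λ i → ℤ→ℚ-neg (n i)) ⟨
    comb (λ i → ℤ→ℚ (ℤ.- n i)) basis  ∎)
    where open ≡-Reasoning

module Residues (A : QuatAlg) (O : Lattice) (ξ : Quat) where
  open QuaternionRing A

  _~_ : Quat → Quat → Set
  _~_ = _≡ξ_ A O ξ

  ~-refl : ∀ {α} → α ~ α
  ~-refl {α} = 0H , 0H∈L O , trans (x-x≡0H α) (sym (⋆-zeroʳ ξ))

  ~-sym : ∀ {α β} → α ~ β → β ~ α
  ~-sym {α} {β} (γ , γ∈O , α-β≡ξγ) = -H γ , -H-∈L O γ∈O , (begin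
    β -H α        ≡⟨ -[x-y]≡y-x α β ⟨
    -H (α -H β)   ≡⟨ cong -H_ α-β≡ξγ ⟩
    -H (ξ ⋆ γ)    ≡⟨ -‿distribʳ-⋆ ξ γ ⟩
    ξ ⋆ (-H γ)    ∎)
    where open ≡-Reasoning

  ~-trans : ∀ {α β δ} → α ~ β → β ~ δ → α ~ δ
  ~-trans {α} {β} {δ} (γ , γ∈O , α-β≡ξγ) (γ' , γ'∈O , β-δ≡ξγ') = γ +H γ' , +H-∈L O γ∈O γ'∈O , (begin
    α -H δ                     ≡⟨ [x-y]+[y-z]≡x-z α β δ ⟨
    (α -H β) +H (β -H δ)       ≡⟨ cong₂ _+H_ α-β≡ξγ β-δ≡ξγ' ⟩
    (ξ ⋆ γ) +H (ξ ⋆ γ')        ≡⟨ ⋆-distribˡ-+ ξ γ γ' ⟨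
    ξ ⋆ (γ +H γ')              ∎)
    where open ≡-Reasoning

  ~-reflexive : ∀ {α β} → α ≡ β → α ~ β
  ~-reflexive {α} refl = ~-refl {α}

  ≡N-reflexive : ∀ {α β} → α ≡ β → _≡N_ A O ξ α β
  ≡N-reflexive {α} refl = 0H , 0H∈L O , trans (x-x≡0H α) (sym (·H-zeroʳ (Nm A ξ)))

  module _ (isOrder : IsOrder A O) where
    private
      1∈O : 1H ∈L O
      1∈O = proj₁ isOrder

      ⋆-∈O : ∀ {x y} → x ∈L O → y ∈L O → (x ⋆ y) ∈L O
      ⋆-∈O {x} {y} = proj₂ isOrder x y

    ~-⋆-congʳ : ∀ {α β u} → u ∈L O → α ~ β → (α ⋆ u) ~ (β ⋆ u)
    ~-⋆-congʳ {α} {β} {u} u∈O (γ , γ∈O , α-β≡ξγ) = γ ⋆ u , ⋆-∈O γ∈O u∈O , (begin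
      (α ⋆ u) -H (β ⋆ u)   ≡⟨ ⋆-distribʳ-- α β u ⟨
      (α -H β) ⋆ u         ≡⟨ cong (_⋆ u) α-β≡ξγ ⟩
      (ξ ⋆ γ) ⋆ u          ≡⟨ ⋆-assoc ξ γ u ⟩
      ξ ⋆ (γ ⋆ u)          ∎)
      where open ≡-Reasoning

    ~-∈O : ξ ∈L O → ∀ {α β} → α ∈L O → β ~ α → β ∈L O
    ~-∈O ξ∈O {α} {β} α∈O (γ , γ∈O , β-α≡ξγ) =
      subst (_∈L O) (trans (cong (_+H α) (sym β-α≡ξγ)) ([x-y]+y≡x β α))
            (+H-∈L O (⋆-∈O ξ∈O γ∈O) α∈O)

    Unit-⋆ : ∀ u w → Unit A O ξ u → Unit A O ξ w → Unit A O ξ (u ⋆ w)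
    Unit-⋆ u w (u∈O , u' , u'∈O , uu'≡1 , u'u≡1) (w∈O , w' , w'∈O , ww'≡1 , w'w≡1) =
      ⋆-∈O u∈O w∈O , w' ⋆ u' , ⋆-∈O w'∈O u'∈O ,
      inverse u w u' w' uu'≡1 ww'≡1 , inverse w' u' w u w'w≡1 u'u≡1
      where
      inverse : ∀ x y x' y' → x ⋆ x' ≡ 1H → y ⋆ y' ≡ 1H → (x ⋆ y) ⋆ (y' ⋆ x') ≡ 1H
      inverse x y x' y' xx'≡1 yy'≡1 = begin
        (x ⋆ y) ⋆ (y' ⋆ x')   ≡⟨ ⋆-assoc x y (y' ⋆ x') ⟩
        x ⋆ (y ⋆ (y' ⋆ x'))   ≡⟨ cong (x ⋆_) (⋆-assoc y y' x') ⟨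
        x ⋆ ((y ⋆ y') ⋆ x')   ≡⟨ cong (λ t → x ⋆ (t ⋆ x')) yy'≡1 ⟩
        x ⋆ (1H ⋆ x')         ≡⟨ cong (x ⋆_) (⋆-identityˡ x') ⟩
        x ⋆ x'                ≡⟨ xx'≡1 ⟩
        1H                    ∎
        where open ≡-Reasoning

    Unit-1H : Unit A O ξ 1H
    Unit-1H = 1∈O , 1H , 1∈O , ⋆-identityˡ 1H , ⋆-identityˡ 1H

    Unit⇒InRUnits : ∀ u → Unit A O ξ u → InRUnits A O ξ u
    Unit⇒InRUnits u (u∈O , u' , u'∈O , uu'≡1 , u'u≡1) =
      u∈O , u , (u∈O , u' , u'∈O , ≡N-reflexive uu'≡1 , ≡N-reflexive u'u≡1) , ~-refl {u}

    InRUnits-resp-~ : ∀ {α β} → β ∈L O → β ~ α → InRUnits A O ξ α → InRUnits A O ξ β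
    InRUnits-resp-~ {α} {β} β∈O β~α (_ , α' , α'-unit , α~α') =
      β∈O , α' , α'-unit , ~-trans {β} {α} {α'} β~α α~α'

    UnitsSurjective : Set
    UnitsSurjective = ∀ α → InRUnits A O ξ α → Σ Quat λ u → Unit A O ξ u × (α ~ u)

    module _ (R : Quat → Quat → Set) (R-⋆-congˡ : ∀ c {x y} → R x y → R (c ⋆ x) (c ⋆ y)) where

      ActsFreely : Set
      ActsFreely = ∀ α u → InRUnits A O ξ α → Unit A O ξ u → (α ⋆ u) ~ α → R u 1H

      UnitsInjective : Set
      UnitsInjective = ∀ u v → Unit A O ξ u → Unit A O ξ v → u ~ v → R u v

      R-cancelˡ : ∀ c d x {y z} → c ⋆ d ≡ 1H → c ⋆ y ≡ z → R (d ⋆ x) y → R x z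
      R-cancelˡ c d x cd≡1 cy≡z r = subst₂ R (⋆-cancelˡ c d x cd≡1) cy≡z (R-⋆-congˡ c r)

      free⇒unitsInjective : ActsFreely → UnitsInjective
      free⇒unitsInjective free u v u-unit v-unit@(v∈O , v' , v'∈O , vv'≡1 , v'v≡1) u~v =
        R-cancelˡ v v' u vv'≡1 (⋆-identityʳ v)
          (free v (v' ⋆ u) (Unit⇒InRUnits v v-unit) (Unit-⋆ v' u v'-unit u-unit) v[v'u]~v)
        where
        v'-unit : Unit A O ξ v'
        v'-unit = v'∈O , v , v∈O , v'v≡1 , vv'≡1
        v[v'u]~v : (v ⋆ (v' ⋆ u)) ~ v
        v[v'u]~v = subst (_~ v) (sym (⋆-cancelˡ v v' u vv'≡1)) u~v

      unitsInjective⇒free : UnitsSurjective → UnitsInjective → ActsFreely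
      unitsInjective⇒free surjective injective α u αR u-unit αu~α with surjective α αR
      ... | w , w-unit@(_ , w' , _ , _ , w'w≡1) , α~w =
        R-cancelˡ w' w u w'w≡1 w'w≡1 (injective (w ⋆ u) w (Unit-⋆ w u w-unit u-unit) w-unit wu~w)
        where
        wu~w : (w ⋆ u) ~ w
        wu~w = ~-trans {w ⋆ u} {α ⋆ u} {w}
                 (~-sym {α ⋆ u} {w ⋆ u} (~-⋆-congʳ {α} {w} {u} (proj₁ u-unit) α~w))
                 (~-trans {α ⋆ u} {α} {w} αu~α α~w)

    primary⇒rightUnit : IsPrimaryClassSet A O ξ (OneClass A O ξ) → RightUnitProperty A O ξ
    primary⇒rightUnit (_ , meets , _ , free , free±) =
      Unit⇒InRUnits , surjective ,
      (λ 2∉ξO → free⇒unitsInjective _≡_ (λ c → cong (c ⋆_)) (free 2∉ξO)) ,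
      (λ 2∈ξO → free⇒unitsInjective _≈±_ ≈±-⋆-congˡ (free± 2∈ξO))
      where
      surjective : UnitsSurjective
      surjective α αR with meets α αR
      ... | β , β~1 , u , u-unit , α~βu = u , u-unit ,
        ~-trans {α} {β ⋆ u} {u} α~βu
          (subst ((β ⋆ u) ~_) (⋆-identityˡ u) (~-⋆-congʳ {β} {1H} {u} (proj₁ u-unit) β~1))

    rightUnit⇒primary : ξ ∈L O → RightUnitProperty A O ξ → IsPrimaryClassSet A O ξ (OneClass A O ξ)
    rightUnit⇒primary ξ∈O (_ , surjective , injective , injective±) =
      (λ β β~1 → InRUnits-resp-~ {1H} {β} (~-∈O ξ∈O 1∈O β~1) β~1 (Unit⇒InRUnits 1H Unit-1H)) ,
      (λ α αR → meets α (surjective α αR)) ,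
      (λ β β' β~1 β'~1 _ → ~-trans {β} {1H} {β'} β~1 (~-sym {β'} {1H} β'~1)) ,
      (λ 2∉ξO → unitsInjective⇒free _≡_ (λ c → cong (c ⋆_)) surjective (injective 2∉ξO)) ,
      (λ 2∈ξO → unitsInjective⇒free _≈±_ ≈±-⋆-congˡ surjective (injective± 2∈ξO))
      where
      meets : ∀ α → (Σ Quat λ u → Unit A O ξ u × (α ~ u)) →
              Σ Quat λ β → OneClass A O ξ β × Σ Quat λ u → Unit A O ξ u × (α ~ (β ⋆ u))
      meets α (u , u-unit , α~u) =
        1H , ~-refl {1H} , u , u-unit ,
        ~-trans {α} {u} {1H ⋆ u} α~u (~-reflexive (sym (⋆-identityˡ u)))

mainTheorem2 : (A : QuatAlg) → Definite A →
    (O : Lattice) → IsEichlerOrder A O → ClassNumberOne A O →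
    (ξ : Quat) → ξ ∈L O →
    IsPrimaryClassSet A O ξ (OneClass A O ξ) ⇔ RightUnitProperty A O ξ
mainTheorem2 A _ O (isOrder , _) _ ξ ξ∈O =
  mk⇔ (primary⇒rightUnit isOrder) (rightUnit⇒primary isOrder ξ∈O)
  where open Residues A O ξ
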